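{- $R(K_3, K_4, C_4, C_4) \ge 49$. Equivalently, there exists a $4$-coloring of the edges of $K_{48}$ with colors $1,2,3,4$ containing no triangle $K_3$ in color $1$, no $K_4$ in color $2$, no $4$-cycle $C_4$ in color $3$, and no $4$-cycle $C_4$ in color $4$ (a copy in color $i$ meaning a subgraph, not necessarily induced, all of whose edges have color $i$).
   Context: For graphs $G_1,\dots,G_k$, the multicolor Ramsey number $R(G_1,\dots,G_k)$ is the smallest $n$ such that every $k$-coloring of the edges of the complete graph $K_n$ (with colors $1,\dots,k$) contains, for some $i$, a copy of $G_i$ (as a not necessarily induced subgraph) all of whose edges have color $i$. $C_m$ denotes the cycle on $m$ vertices. -}

module Defs where

open import Data.Nat using (ℕ)
open import Data.Fin using (Fin; zero; suc)
open import Data.Product using (Σ; ∃; _×_; _,_)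
open import Relation.Binary.PropositionalEquality using (_≡_; _≢_)
open import Relation.Nullary using (¬_)

col1 col2 col3 col4 : Fin 4
col1 = zero
col2 = suc zero
col3 = suc (suc zero)
col4 = suc (suc (suc zero))

-- A 4-coloring of the edges of K_n: a symmetric function on pairs of
-- vertices; values on the diagonal (x , x) are irrelevant (not edges).
record EdgeColoring (n : ℕ) : Set where
  field
    col : Fin n → Fin n → Fin 4
    sym : ∀ x y → col x y ≡ col y x
open EdgeColoring public

MonoK3 : ∀ {n} → EdgeColoring n → Fin 4 → Set
MonoK3 {n} χ i = Σ (Fin n) λ a → Σ (Fin n) λ b → Σ (Fin n) λ c →
  (a ≢ b × a ≢ c × b ≢ c) ×
  (col χ a b ≡ i × col χ a c ≡ i × col χ b c ≡ i)

MonoK4 : ∀ {n} → EdgeColoring n → Fin 4 → Set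
MonoK4 {n} χ i = Σ (Fin n) λ a → Σ (Fin n) λ b → Σ (Fin n) λ c → Σ (Fin n) λ d →
  (a ≢ b × a ≢ c × a ≢ d × b ≢ c × b ≢ d × c ≢ d) ×
  (col χ a b ≡ i × col χ a c ≡ i × col χ a d ≡ i ×
   col χ b c ≡ i × col χ b d ≡ i × col χ c d ≡ i)

MonoC4 : ∀ {n} → EdgeColoring n → Fin 4 → Set
MonoC4 {n} χ i = Σ (Fin n) λ a → Σ (Fin n) λ b → Σ (Fin n) λ c → Σ (Fin n) λ d →
  (a ≢ b × a ≢ c × a ≢ d × b ≢ c × b ≢ d × c ≢ d) ×
  (col χ a b ≡ i × col χ b c ≡ i × col χ c d ≡ i × col χ d a ≡ i)

Good : ∀ {n} → EdgeColoring n → Set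
Good χ = ¬ MonoK3 χ col1 × ¬ MonoK4 χ col2 × ¬ MonoC4 χ col3 × ¬ MonoC4 χ col4

-- The colouring lives on six blocks of eight vertices and is invariant under rotating all
-- blocks simultaneously; colour 1, for instance, joins two vertices exactly when their
-- positions in their blocks differ by ±1 or 4 modulo 8, hence is triangle-free since
-- {±1, 4} is sum-free in ℤ/8. The forbidden subgraphs are excluded by exhaustive search,
-- C₄ in the form "two distinct vertices have at most one common neighbour". Rotations
-- preserve the colouring and move every vertex to the first vertex of its block, so the
-- search only needs to start at those six vertices.
{-# OPTIONS --safe #-}
module Submission where

open import Defs
open import Data.Nat using (ℕ; _+_; _*_; _∸_; _^_; _/_; _%_)
import Data.Nat as ℕ
open import Data.Nat.DivMod using (_mod_)
open import Data.Nat.Properties using (m^n≢0)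
open import Data.Fin using (Fin; toℕ)
open import Data.Fin.Properties using (_≟_; all?; any?)
open import Data.Product using (Σ; ∃; _×_; _,_)
open import Function.Definitions using (Injective)
open import Function.Consequences.Propositional
  using (inverseʳ⇒injective; strictlyInverseʳ⇒inverseʳ)
open import Relation.Binary.PropositionalEquality using (_≡_; _≢_; ≢-sym; trans)
open import Relation.Nullary using (¬_; Dec; ¬?; _×-dec_; _→-dec_)
open import Relation.Nullary.Decidable using (True; toWitness; from-yes)

record Automorphism {n} (χ : EdgeColoring n) : Set where
  field
    to            : Fin n → Fin n
    injective     : Injective _≡_ _≡_ to
    col-preserved : ∀ x y → col χ (to x) (to y) ≡ col χ x y

module _ {n} (χ : EdgeColoring n) (i : Fin 4) where

  infix 4 _~_ _~?_

  -- Distinctness is part of adjacency since the colouring takes junk values on the diagonal.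
  _~_ : Fin n → Fin n → Set
  a ~ b = col χ a b ≡ i × a ≢ b

  _~?_ : ∀ a b → Dec (a ~ b)
  a ~? b = col χ a b ≟ i ×-dec ¬? (a ≟ b)

  NoTriangleAt : Fin n → Set
  NoTriangleAt a = ∀ b → a ~ b → ∀ c → a ~ c → ¬ b ~ c

  noTriangleAt? : ∀ a → Dec (NoTriangleAt a)
  noTriangleAt? a = all? λ b → a ~? b →-dec all? λ c → a ~? c →-dec ¬? (b ~? c)

  NoK4At : Fin n → Set
  NoK4At a = ∀ b → a ~ b → ∀ c → a ~ c → b ~ c → ∀ d → a ~ d → b ~ d → ¬ c ~ d

  noK4At? : ∀ a → Dec (NoK4At a)
  noK4At? a = all? λ b → a ~? b →-dec all? λ c → a ~? c →-dec b ~? c →-dec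
              all? λ d → a ~? d →-dec b ~? d →-dec ¬? (c ~? d)

  CommonNeighbour : Fin n → Fin n → Fin n → Set
  CommonNeighbour a c b = a ~ b × c ~ b

  AtMostOneCommonNeighbourAt : Fin n → Set
  AtMostOneCommonNeighbourAt a =
    ∀ c → a ≢ c → ∀ b → CommonNeighbour a c b → ∀ d → CommonNeighbour a c d → b ≡ d

  atMostOneCommonNeighbourAt? : ∀ a → Dec (AtMostOneCommonNeighbourAt a)
  atMostOneCommonNeighbourAt? a =
    all? λ c → ¬? (a ≟ c) →-dec all? λ b → (a ~? b ×-dec c ~? b) →-dec
    all? λ d → (a ~? d ×-dec c ~? d) →-dec b ≟ d

  ¬MonoK3 : (∀ a → NoTriangleAt a) → ¬ MonoK3 χ i
  ¬MonoK3 free (a , b , c , (a≢b , a≢c , b≢c) , (ab , ac , bc)) =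
    free a b (ab , a≢b) c (ac , a≢c) (bc , b≢c)

  ¬MonoK4 : (∀ a → NoK4At a) → ¬ MonoK4 χ i
  ¬MonoK4 free (a , b , c , d , (a≢b , a≢c , a≢d , b≢c , b≢d , c≢d)
                              , (ab , ac , ad , bc , bd , cd)) =
    free a b (ab , a≢b) c (ac , a≢c) (bc , b≢c) d (ad , a≢d) (bd , b≢d) (cd , c≢d)

  ¬MonoC4 : (∀ a → AtMostOneCommonNeighbourAt a) → ¬ MonoC4 χ i
  ¬MonoC4 unique (a , b , c , d , (a≢b , a≢c , a≢d , b≢c , b≢d , c≢d) , (ab , bc , cd , da)) =
    b≢d (unique a c a≢c b ((ab , a≢b) , (trans (sym χ c b) bc , ≢-sym b≢c))
                        d ((trans (sym χ a d) da , a≢d) , (cd , c≢d)))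

  module _ (σ : Automorphism χ) where
    open Automorphism σ

    ~-to : ∀ {a b} → a ~ b → to a ~ to b
    ~-to (ab , a≢b) = trans (col-preserved _ _) ab , λ eq → a≢b (injective eq)

    NoTriangleAt-reflect : ∀ {a} → NoTriangleAt (to a) → NoTriangleAt a
    NoTriangleAt-reflect free b ab c ac bc = free (to b) (~-to ab) (to c) (~-to ac) (~-to bc)

    NoK4At-reflect : ∀ {a} → NoK4At (to a) → NoK4At a
    NoK4At-reflect free b ab c ac bc d ad bd cd =
      free (to b) (~-to ab) (to c) (~-to ac) (~-to bc) (to d) (~-to ad) (~-to bd) (~-to cd)

    AtMostOneCommonNeighbourAt-reflect :
      ∀ {a} → AtMostOneCommonNeighbourAt (to a) → AtMostOneCommonNeighbourAt a
    AtMostOneCommonNeighbourAt-reflect unique c a≢c b (ab , cb) d (ad , cd) =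
      injective (unique (to c) (λ eq → a≢c (injective eq))
                        (to b) (~-to ab , ~-to cb) (to d) (~-to ad , ~-to cd))

-- Vertex 8 p + x is vertex x of block p. Decimal digit k (from the left) of baseRow p is
-- the colour, written 0–3 for colours 1–4, of the edge from vertex 8 p to vertex k; the
-- remaining edges are obtained by rotating all blocks simultaneously.
baseRow : ℕ → ℕ
baseRow 0 = 001101103011011020110110301301102011011020310110
baseRow 1 = 301101100011011020110110201101103011011030320110
baseRow 2 = 201101102011011000110110302101103011011020130110
baseRow 3 = 301103102011011030110120001101102011011010220230
baseRow 4 = 201101103011011030110110201101100011011030230110
baseRow _ = 201101303011023020110310103202203011032000110110

digit : ℕ → ℕ → ℕ
digit w k = ((w / 10 ^ (47 ∸ k)) ⦃ m^n≢0 10 (47 ∸ k) ⦄) % 10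

colour : Fin 48 → Fin 48 → Fin 4
colour x y = digit (baseRow (u / 8)) (8 * (v / 8) + (8 + v % 8 ∸ u % 8) % 8) mod 4
  where u = toℕ x ; v = toℕ y

colour-sym : ∀ x y → colour x y ≡ colour y x
colour-sym = from-yes (all? λ x → all? λ y → colour x y ≟ colour y x)

χ₄₈ : EdgeColoring 48
χ₄₈ = record { col = colour ; sym = colour-sym }

rotate : ℕ → Fin 48 → Fin 48
rotate k x = (8 * (u / 8) + (u % 8 + k) % 8) mod 48
  where u = toℕ x

rotate-colour : ∀ (k : Fin 8) x y → colour (rotate (toℕ k) x) (rotate (toℕ k) y) ≡ colour x y
rotate-colour = from-yes (all? λ (k : Fin 8) → all? λ x → all? λ y →
                  colour (rotate (toℕ k) x) (rotate (toℕ k) y) ≟ colour x y)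

rotate-inverse : ∀ (k : Fin 8) x → rotate (8 ∸ toℕ k) (rotate (toℕ k) x) ≡ x
rotate-inverse = from-yes (all? λ (k : Fin 8) → all? λ x →
                   rotate (8 ∸ toℕ k) (rotate (toℕ k) x) ≟ x)

rotation : Fin 8 → Automorphism χ₄₈
rotation k = record
  { to            = rotate (toℕ k)
  ; injective     = inverseʳ⇒injective {f⁻¹ = rotate (8 ∸ toℕ k)} (rotate (toℕ k))
                      (strictlyInverseʳ⇒inverseʳ (rotate (toℕ k)) (rotate-inverse k))
  ; col-preserved = rotate-colour k
  }

IsBlockHead : Fin 48 → Set
IsBlockHead x = toℕ x % 8 ≡ 0

isBlockHead? : ∀ x → Dec (IsBlockHead x)
isBlockHead? x = toℕ x % 8 ℕ.≟ 0

rotateToBlockHead : ∀ x → ∃ λ (k : Fin 8) → IsBlockHead (rotate (toℕ k) x)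
rotateToBlockHead = from-yes (all? λ x → any? λ (k : Fin 8) → isBlockHead? (rotate (toℕ k) x))

atBlockHeads? : {P : Fin 48 → Set} → (∀ a → Dec (P a)) → Dec (∀ a → IsBlockHead a → P a)
atBlockHeads? P? = all? λ a → isBlockHead? a →-dec P? a

fromBlockHeads : {P : Fin 48 → Set} (P? : ∀ a → Dec (P a)) →
                 (∀ k {a} → P (rotate (toℕ k) a) → P a) →
                 True (atBlockHeads? P?) → ∀ a → P a
fromBlockHeads P? reflect atHeads a with rotateToBlockHead a
... | k , head = reflect k (toWitness atHeads _ head)

theorem2 : Σ (EdgeColoring 48) Good
theorem2 = χ₄₈ , ¬MonoK3 χ₄₈ col1 noTriangle , ¬MonoK4 χ₄₈ col2 noK4
               , ¬MonoC4 χ₄₈ col3 (atMostOneCommonNeighbour col3 _)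
               , ¬MonoC4 χ₄₈ col4 (atMostOneCommonNeighbour col4 _)
  where
  noTriangle : ∀ a → NoTriangleAt χ₄₈ col1 a
  noTriangle = fromBlockHeads (noTriangleAt? χ₄₈ col1)
                 (λ k → NoTriangleAt-reflect χ₄₈ col1 (rotation k)) _

  noK4 : ∀ a → NoK4At χ₄₈ col2 a
  noK4 = fromBlockHeads (noK4At? χ₄₈ col2) (λ k → NoK4At-reflect χ₄₈ col2 (rotation k)) _

  atMostOneCommonNeighbour : ∀ i → True (atBlockHeads? (atMostOneCommonNeighbourAt? χ₄₈ i)) →
                             ∀ a → AtMostOneCommonNeighbourAt χ₄₈ i a
  atMostOneCommonNeighbour i = fromBlockHeads (atMostOneCommonNeighbourAt? χ₄₈ i)
                                 (λ k → AtMostOneCommonNeighbourAt-reflect χ₄₈ i (rotation k))
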